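{- Let $F(X,Y)$ be a propositional formula over disjoint sets of variables $X$ (relevant) and $Y$ (irrelevant). Let $P_0$ be a CNF obtained from $F$ by the Tseitin transformation, over $X\cup Y\cup S$ with $\exists S\,[P_0]\equiv F$, and let $N_0 = t_0 \wedge \mathrm{Tseitin}(t_0 \leftrightarrow \neg F)$, a CNF over $X\cup Y\cup T$ (with $t_0\in T$, $S\cap T=\emptyset$) satisfying $\exists T\,[N_0]\equiv \neg F$. Suppose that for $i=0,1,\dots,n$ we are given an assignment $I_{i+1}$ with $I_{i+1}\vdash P_i$ and a cube (set of literals) $I^*_{i+1}\subseteq I_{i+1}$ such that $I^*_{i+1}|_{X\cup Y}\wedge N_i$ is unsatisfiable, and that the formulas are updated by $$P_{i+1} = P_i \wedge \neg\big(I^*_{i+1}|_X\big),$$ $$N_{i+1} = \Big(t_0 \vee \bigvee_{k=1}^{i+1} t_k\Big) \wedge \mathrm{Tseitin}(t_0\leftrightarrow \neg F)\wedge \bigwedge_{k=1}^{i+1}\mathrm{Tseitin}\big(t_k\leftrightarrow I^*_k|_X\big),$$ where $t_1,t_2,\dots$ are fresh variables added to $T$ (so $N_{i+1}$ is obtained from $N_i$ by replacing the clause $(t_0\vee\bigvee_{k=1}^{i}t_k)$ by $(t_0\vee\bigvee_{k=1}^{i+1}t_k)$ and adding $\mathrm{Tseitin}(t_{i+1}\leftrightarrow I^*_{i+1}|_X)$). Then for all $i\neq j$ in $\{1,\dots,n+1\}$, the cubes $I^*_i|_X$ and $I^*_j|_X$ are contradicting, i.e. $I^*_i|_X\wedge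 I^*_j|_X\equiv \bot$.
   Context: A literal is a variable or its negation; a cube is a conjunction (set) of literals, a clause a disjunction. For a cube or assignment $I$ and a set of variables $Z$, $I|_Z$ denotes the restriction (projection) of $I$ to literals whose variables lie in $Z$, and $\neg(I|_X)$ is the clause of the complements of the literals of $I|_X$. For a partial assignment $I$ and formula $G$, $I\vdash G$ means that the residual of $G$ under $I$ (the formula obtained by substituting the values of $I$) is $\top$. $\mathrm{Tseitin}(G)$ denotes the CNF produced by the Tseitin transformation of $G$, introducing fresh auxiliary variables; it is satisfiability preserving, and existentially quantifying its auxiliary variables yields a formula equivalent to $G$. -}

module Defs where

open import Data.Nat using (ℕ; zero; suc)
open import Data.Bool using (Bool; true; false; not; _∧_; _∨_; if_then_else_)
open import Data.List using (List; []; _∷_; _++_; map)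
open import Data.List.Relation.Unary.All using (All)
open import Data.List.Relation.Unary.Any using (Any)
open import Data.List.Membership.Propositional using (_∈_)
open import Data.Product using (Σ; _×_; ∃)
open import Relation.Binary.PropositionalEquality using (_≡_)
open import Relation.Nullary using (¬_)
open import Function.Bundles using (_⇔_)
open import Data.Sum using (_⊎_)
open import Data.Empty using (⊥)

Var : Set
Var = ℕ

VarSet : Set
VarSet = Var → Bool

Assignment : Set
Assignment = Var → Bool

data Formula : Set where
  var  : Var → Formula
  ⊤ᶠ ⊥ᶠ : Formula
  ¬ᶠ_  : Formula → Formula
  _∧ᶠ_ _∨ᶠ_ _↔ᶠ_ : Formula → Formula → Formula

infix  9 ¬ᶠ_
infixr 7 _∧ᶠ_
infixr 6 _∨ᶠ_
infix  5 _↔ᶠ_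

_xnor_ : Bool → Bool → Bool
true  xnor b = b
false xnor b = not b

⟦_⟧ : Formula → Assignment → Bool
⟦ var x ⟧ σ = σ x
⟦ ⊤ᶠ ⟧ σ = true
⟦ ⊥ᶠ ⟧ σ = false
⟦ ¬ᶠ G ⟧ σ = not (⟦ G ⟧ σ)
⟦ G ∧ᶠ H ⟧ σ = ⟦ G ⟧ σ ∧ ⟦ H ⟧ σ
⟦ G ∨ᶠ H ⟧ σ = ⟦ G ⟧ σ ∨ ⟦ H ⟧ σ
⟦ G ↔ᶠ H ⟧ σ = ⟦ G ⟧ σ xnor ⟦ H ⟧ σ

data OccursF (v : Var) : Formula → Set where
  here  : OccursF v (var v)
  ¬-occ : ∀ {G} → OccursF v G → OccursF v (¬ᶠ G)
  ∧-l : ∀ {G H} → OccursF v G → OccursF v (G ∧ᶠ H)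
  ∧-r : ∀ {G H} → OccursF v H → OccursF v (G ∧ᶠ H)
  ∨-l : ∀ {G H} → OccursF v G → OccursF v (G ∨ᶠ H)
  ∨-r : ∀ {G H} → OccursF v H → OccursF v (G ∨ᶠ H)
  ↔-l : ∀ {G H} → OccursF v G → OccursF v (G ↔ᶠ H)
  ↔-r : ∀ {G H} → OccursF v H → OccursF v (G ↔ᶠ H)

data Lit : Set where
  pos neg : Var → Lit

litVar : Lit → Var
litVar (pos x) = x
litVar (neg x) = x

∼_ : Lit → Lit
∼ pos x = neg x
∼ neg x = pos x

Cube : Set
Cube = List Lit

Clause : Set
Clause = List Lit

CNF : Set
CNF = List Clause

litVal : Assignment → Lit → Bool
litVal σ (pos x) = σ x
litVal σ (neg x) = not (σ x)

_⊨ˡ_ : Assignment → Lit → Set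
σ ⊨ˡ l = litVal σ l ≡ true

_⊨ᶜᵘ_ : Assignment → Cube → Set
σ ⊨ᶜᵘ c = All (σ ⊨ˡ_) c

_⊨ᶜˡ_ : Assignment → Clause → Set
σ ⊨ᶜˡ c = Any (σ ⊨ˡ_) c

_⊨_ : Assignment → CNF → Set
σ ⊨ P = All (σ ⊨ᶜˡ_) P

OccursC : Var → CNF → Set
OccursC v P = Any (Any (λ l → litVar l ≡ v)) P

restrict : VarSet → Cube → Cube
restrict Z [] = []
restrict Z (l ∷ c) = if Z (litVar l) then l ∷ restrict Z c else restrict Z c

negCube : Cube → Clause
negCube c = map ∼_ c

litF : Lit → Formula
litF (pos x) = var x
litF (neg x) = ¬ᶠ var x

cubeF : Cube → Formula
cubeF [] = ⊤ᶠ
cubeF (l ∷ c) = litF l ∧ᶠ cubeF c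

_∪_ : VarSet → VarSet → VarSet
(A ∪ B) v = A v ∨ B v

UnsatWith : Cube → CNF → Set
UnsatWith c P = ¬ (Σ Assignment λ σ → σ ⊨ᶜᵘ c × σ ⊨ P)

Contradicting : Cube → Cube → Set
Contradicting c d = ¬ (Σ Assignment λ σ → σ ⊨ᶜᵘ c × σ ⊨ᶜᵘ d)

AgreeOff : VarSet → Assignment → Assignment → Set
AgreeOff Z σ σ' = ∀ v → Z v ≡ false → σ' v ≡ σ v

ExistsEquiv : VarSet → CNF → Formula → Set
ExistsEquiv Z P G =
  ∀ σ → (Σ Assignment λ σ' → AgreeOff Z σ σ' × σ' ⊨ P) ⇔ (⟦ G ⟧ σ ≡ true)

-- a partial assignment: a cube without complementary literals
Consistent : Cube → Set
Consistent I = ∀ x → pos x ∈ I → neg x ∈ I → ⊥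

-- I ⊢ P : the residual of the CNF P under the partial assignment I is ⊤,
-- i.e. every clause of P contains a literal of I
_⊢_ : Cube → CNF → Set
I ⊢ P = All (Any (_∈ I)) P

record IsTseitin (G : Formula) (Aux : VarSet) (C : CNF) : Set where
  field
    aux-fresh : ∀ v → Aux v ≡ true → ¬ OccursF v G
    vars      : ∀ v → OccursC v C → OccursF v G ⊎ Aux v ≡ true
    equiv     : ExistsEquiv Aux C G

Pseq : CNF → VarSet → (ℕ → Cube) → ℕ → CNF
Pseq P₀ X I* zero = P₀
Pseq P₀ X I* (suc i) = Pseq P₀ X I* i ++ (negCube (restrict X (I* (suc i))) ∷ [])

tClause : (ℕ → Var) → ℕ → Clause
tClause t zero = pos (t zero) ∷ []
tClause t (suc i) = tClause t i ++ (pos (t (suc i)) ∷ [])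

tseitinTarget : Formula → VarSet → (ℕ → Var) → (ℕ → Cube) → ℕ → Formula
tseitinTarget F X t I* zero = var (t zero) ↔ᶠ ¬ᶠ F
tseitinTarget F X t I* (suc k) = var (t (suc k)) ↔ᶠ cubeF (restrict X (I* (suc k)))

-- C k is Tseitin(tseitinTarget k);  Cs C i = C 0 ∧ ... ∧ C i
Cs : (ℕ → CNF) → ℕ → CNF
Cs C zero = C zero
Cs C (suc i) = Cs C i ++ C (suc i)

Nseq : (ℕ → Var) → (ℕ → CNF) → ℕ → CNF
Nseq t C i = tClause t i ∷ Cs C i

module Submission where

open import Defs
open import Data.Nat using (ℕ; zero; suc; _≤_)
open import Data.Bool using (Bool; true; false; _∨_)
open import Data.List.Relation.Binary.Subset.Propositional using (_⊆_)
open import Relation.Binary.PropositionalEquality using (_≡_; _≢_)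

open import Data.Nat using (z≤n; _<_; _≟_)
open import Data.Nat.Properties using (≤-refl; ≤-trans; 1+n≰n; ≤-pred; m≤n⇒m≤1+n; m≤n⇒m<n∨m≡n; n≤1+n; <-cmp)
open import Data.Bool using (not; _∧_; if_then_else_)
open import Data.Bool.Properties using (¬-not; not-¬)
open import Data.List using ([]; _∷_; _++_)
open import Data.List.Relation.Unary.All using ([]; _∷_; tabulate; lookup)
open import Data.List.Relation.Unary.All.Properties using (++⁺; ++⁻ˡ; ++⁻ʳ)
open import Data.List.Relation.Unary.Any using (Any; here; there)
open import Data.List.Relation.Unary.Any.Properties using (++⁻)
open import Data.List.Membership.Propositional using (_∈_; lose)
open import Data.List.Membership.Propositional.Properties using (∈-++⁺ˡ; ∈-++⁺ʳ)
import Data.List.Membership.DecPropositional as DecMembership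
open import Data.Product using (Σ; _×_; _,_; proj₁; proj₂; map₁; map₂; swap)
open import Data.Sum using (_⊎_; inj₁; inj₂)
open import Function using (_∘_)
open import Function.Bundles using (Equivalence)
open import Relation.Nullary using (¬_; does; no; contradiction)
open import Relation.Nullary.Decidable using (dec-true; dec-false; map′)
open import Relation.Binary.Definitions using (DecidableEquality; tri<; tri≈; tri>)
open import Relation.Binary.PropositionalEquality using (refl; sym; trans; cong; cong₂; subst; module ≡-Reasoning)

-- Suppose i < j and some σ satisfies both I*_i|_X and I*_j|_X.  Overwrite σ on Y
-- by the literals of I*_j (possible since I_j is consistent), so that it satisfies
-- I*_j|_{X∪Y}; then give every t_k, k < j, the value of its defining formula and
-- extend to the Tseitin auxiliaries one encoding at a time.  The result satisfies
-- I*_j|_{X∪Y}, all the Tseitin CNFs of N_{j-1}, and the clause (t_0 ∨ … ∨ t_{j-1})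
-- because t_i ↔ I*_i|_X holds and σ agrees on X.  This contradicts the
-- unsatisfiability of I*_j|_{X∪Y} ∧ N_{j-1}.

_≟ˡ_ : DecidableEquality Lit
pos x ≟ˡ pos y = map′ (cong pos) (λ { refl → refl }) (x ≟ y)
pos x ≟ˡ neg y = no λ ()
neg x ≟ˡ pos y = no λ ()
neg x ≟ˡ neg y = map′ (cong neg) (λ { refl → refl }) (x ≟ y)

open DecMembership _≟ˡ_ using (_∈?_)

xnor-self : ∀ b → (b xnor b) ≡ true
xnor-self true = refl
xnor-self false = refl

xnor-true : ∀ {a b} → (a xnor b) ≡ true → b ≡ true → a ≡ true
xnor-true {true} _ _ = refl
xnor-true {false} {true} () refl

∪-introˡ : ∀ (A B : VarSet) {v} → A v ≡ true → (A ∪ B) v ≡ true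
∪-introˡ A B {v} Av rewrite Av = refl

∪-elimˡ : ∀ (A B : VarSet) {v} → (A ∪ B) v ≡ true → B v ≡ false → A v ≡ true
∪-elimˡ A B {v} A∪Bv Bv with A v
... | true = refl
... | false = trans (sym Bv) A∪Bv

⟦⟧-cong : ∀ G {σ ρ} → (∀ v → OccursF v G → σ v ≡ ρ v) → ⟦ G ⟧ σ ≡ ⟦ G ⟧ ρ
⟦⟧-cong (var x) h = h x here
⟦⟧-cong ⊤ᶠ h = refl
⟦⟧-cong ⊥ᶠ h = refl
⟦⟧-cong (¬ᶠ G) h = cong not (⟦⟧-cong G (λ v → h v ∘ ¬-occ))
⟦⟧-cong (G ∧ᶠ H) h = cong₂ _∧_ (⟦⟧-cong G (λ v → h v ∘ ∧-l)) (⟦⟧-cong H (λ v → h v ∘ ∧-r))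
⟦⟧-cong (G ∨ᶠ H) h = cong₂ _∨_ (⟦⟧-cong G (λ v → h v ∘ ∨-l)) (⟦⟧-cong H (λ v → h v ∘ ∨-r))
⟦⟧-cong (G ↔ᶠ H) h = cong₂ _xnor_ (⟦⟧-cong G (λ v → h v ∘ ↔-l)) (⟦⟧-cong H (λ v → h v ∘ ↔-r))

⊨ˡ-cong : ∀ l {σ ρ} → σ (litVar l) ≡ ρ (litVar l) → σ ⊨ˡ l → ρ ⊨ˡ l
⊨ˡ-cong (pos x) e p = trans (sym e) p
⊨ˡ-cong (neg x) e p = subst (λ b → not b ≡ true) e p

⊨ᶜᵘ-cong : ∀ c {σ ρ} → (∀ {l} → l ∈ c → σ (litVar l) ≡ ρ (litVar l)) → σ ⊨ᶜᵘ c → ρ ⊨ᶜᵘ c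
⊨ᶜᵘ-cong c h σ⊨c = tabulate λ {l} l∈c → ⊨ˡ-cong l (h l∈c) (lookup σ⊨c l∈c)

⊨ᶜˡ-cong : ∀ c {σ ρ} → (∀ v → Any (λ l → litVar l ≡ v) c → σ v ≡ ρ v) → σ ⊨ᶜˡ c → ρ ⊨ᶜˡ c
⊨ᶜˡ-cong (l ∷ c) h (here p) = here (⊨ˡ-cong l (h _ (here refl)) p)
⊨ᶜˡ-cong (l ∷ c) h (there p) = there (⊨ᶜˡ-cong c (λ v → h v ∘ there) p)

⊨-cong : ∀ P {σ ρ} → (∀ v → OccursC v P → σ v ≡ ρ v) → σ ⊨ P → ρ ⊨ P
⊨-cong [] h [] = []
⊨-cong (c ∷ P) h (p ∷ ps) = ⊨ᶜˡ-cong c (λ v → h v ∘ here) p ∷ ⊨-cong P (λ v → h v ∘ there) ps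

ExistsEquiv-sound : ∀ {Z P} G {σ} → ExistsEquiv Z P G → σ ⊨ P → ⟦ G ⟧ σ ≡ true
ExistsEquiv-sound G {σ} equiv σ⊨P = Equivalence.to (equiv σ) (σ , (λ _ _ → refl) , σ⊨P)

∈-restrict⁻ : ∀ Z c {l} → l ∈ restrict Z c → l ∈ c × Z (litVar l) ≡ true
∈-restrict⁻ Z (x ∷ c) l∈ with Z (litVar x) in Zx
∈-restrict⁻ Z (x ∷ c) (here refl) | true = here refl , Zx
∈-restrict⁻ Z (x ∷ c) (there l∈) | true = map₁ there (∈-restrict⁻ Z c l∈)
∈-restrict⁻ Z (x ∷ c) l∈ | false = map₁ there (∈-restrict⁻ Z c l∈)

∈-restrict⁺ : ∀ Z c {l} → l ∈ c → Z (litVar l) ≡ true → l ∈ restrict Z c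
∈-restrict⁺ Z (x ∷ c) (here refl) Zl rewrite Zl = here refl
∈-restrict⁺ Z (x ∷ c) (there l∈) Zl with Z (litVar x)
... | true = there (∈-restrict⁺ Z c l∈ Zl)
... | false = ∈-restrict⁺ Z c l∈ Zl

restrict-⊆ : ∀ Z c → restrict Z c ⊆ c
restrict-⊆ Z c = proj₁ ∘ ∈-restrict⁻ Z c

consistent-⊆ : ∀ {c d} → c ⊆ d → Consistent d → Consistent c
consistent-⊆ c⊆d cons x p n = cons x (c⊆d p) (c⊆d n)

⟦cubeF⟧-true : ∀ c {σ} → σ ⊨ᶜᵘ c → ⟦ cubeF c ⟧ σ ≡ true
⟦cubeF⟧-true [] [] = refl
⟦cubeF⟧-true (pos x ∷ c) (p ∷ ps) rewrite p = ⟦cubeF⟧-true c ps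
⟦cubeF⟧-true (neg x ∷ c) (p ∷ ps) rewrite p = ⟦cubeF⟧-true c ps

cubeF-vars : ∀ c {v} → OccursF v (cubeF c) → Σ Lit λ l → l ∈ c × litVar l ≡ v
cubeF-vars (pos x ∷ c) (∧-l here) = pos x , here refl , refl
cubeF-vars (neg x ∷ c) (∧-l (¬-occ here)) = neg x , here refl , refl
cubeF-vars (l ∷ c) (∧-r o) with cubeF-vars c o
... | l′ , l′∈c , refl = l′ , there l′∈c , refl

cubeF-restrict-vars : ∀ Z c {v} → OccursF v (cubeF (restrict Z c)) → Z v ≡ true
cubeF-restrict-vars Z c o with cubeF-vars (restrict Z c) o
... | l , l∈ , refl = proj₂ (∈-restrict⁻ Z c l∈)

_[_≔_] : Assignment → Var → Bool → Assignment
(σ [ x ≔ b ]) v = if does (v ≟ x) then b else σ v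

≔-same : ∀ σ x b → (σ [ x ≔ b ]) x ≡ b
≔-same σ x b rewrite dec-true (x ≟ x) refl = refl

≔-other : ∀ σ x b {v} → v ≢ x → (σ [ x ≔ b ]) v ≡ σ v
≔-other σ x b {v} v≢x rewrite dec-false (v ≟ x) v≢x = refl

override : VarSet → Cube → Assignment → Assignment
override Z c σ v = if Z v then does (pos v ∈? c) else σ v

override-off : ∀ Z c σ {v} → Z v ≡ false → override Z c σ v ≡ σ v
override-off Z c σ Zv rewrite Zv = refl

override-⊨ᶜᵘ : ∀ Z c σ → Consistent c →
               (∀ {l} → l ∈ c → Z (litVar l) ≡ false → σ ⊨ˡ l) → override Z c σ ⊨ᶜᵘ c
override-⊨ᶜᵘ Z c σ cons outside = tabulate satisfied
  where
  satisfied : ∀ {l} → l ∈ c → override Z c σ ⊨ˡ l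
  satisfied {pos v} l∈c with Z v in Zv
  ... | true = dec-true (pos v ∈? c) l∈c
  ... | false = outside l∈c Zv
  satisfied {neg v} l∈c with Z v in Zv
  ... | true = cong not (dec-false (pos v ∈? c) λ p∈c → cons v p∈c l∈c)
  ... | false = outside l∈c Zv

Cs-⊨⁻ : ∀ C {σ k} m → σ ⊨ Cs C m → k ≤ m → σ ⊨ C k
Cs-⊨⁻ C zero σ⊨ z≤n = σ⊨
Cs-⊨⁻ C (suc m) σ⊨ k≤ with m≤n⇒m<n∨m≡n k≤
... | inj₁ k< = Cs-⊨⁻ C m (++⁻ˡ (Cs C m) σ⊨) (≤-pred k<)
... | inj₂ refl = ++⁻ʳ (Cs C m) σ⊨

Cs-vars : ∀ C {v} m → OccursC v (Cs C m) → Σ ℕ λ k → k ≤ m × OccursC v (C k)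
Cs-vars C zero o = zero , z≤n , o
Cs-vars C (suc m) o with ++⁻ (Cs C m) o
... | inj₂ o′ = suc m , ≤-refl , o′
... | inj₁ o′ with Cs-vars C m o′
...   | k , k≤m , o″ = k , m≤n⇒m≤1+n k≤m , o″

tClause-∋ : ∀ t {l} k → l ≤ k → pos (t l) ∈ tClause t k
tClause-∋ t zero z≤n = here refl
tClause-∋ t (suc k) l≤ with m≤n⇒m<n∨m≡n l≤
... | inj₁ l< = ∈-++⁺ˡ (tClause-∋ t k (≤-pred l<))
... | inj₂ refl = ∈-++⁺ʳ (tClause t k) (here refl)

Owned : Var → VarSet → Var → Set
Owned x A v = v ≡ x ⊎ A v ≡ true

≔-defines : ∀ σ {x} G → ¬ OccursF x G → ⟦ var x ↔ᶠ G ⟧ (σ [ x ≔ ⟦ G ⟧ σ ]) ≡ true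
≔-defines σ {x} G x∉G = begin
  (σ [ x ≔ b ]) x xnor ⟦ G ⟧ (σ [ x ≔ b ])   ≡⟨ cong₂ _xnor_ (≔-same σ x b) (⟦⟧-cong G unchanged) ⟩
  b xnor b                                 ≡⟨ xnor-self b ⟩
  true                                     ∎
  where
  open ≡-Reasoning
  b : Bool
  b = ⟦ G ⟧ σ
  unchanged : ∀ v → OccursF v G → (σ [ x ≔ b ]) v ≡ σ v
  unchanged v v∈G = ≔-other σ x b λ { refl → x∉G v∈G }

define-and-extend : ∀ {A C} x G → ¬ OccursF x G → ExistsEquiv A C (var x ↔ᶠ G) →
                    (σ : Assignment) →
                    Σ Assignment λ ρ → (∀ v → ¬ Owned x A v → ρ v ≡ σ v) × ρ ⊨ C
define-and-extend {A} x G x∉G equiv σ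
  with Equivalence.from (equiv (σ [ x ≔ ⟦ G ⟧ σ ])) (≔-defines σ G x∉G)
... | ρ , ρ≈σₓ , ρ⊨C = ρ , agree , ρ⊨C
  where
  agree : ∀ v → ¬ Owned x A v → ρ v ≡ σ v
  agree v unowned = trans (ρ≈σₓ v (¬-not (unowned ∘ inj₂))) (≔-other σ x _ (unowned ∘ inj₁))

chain-extend : (x : ℕ → Var) (G : ℕ → Formula) (Aux : ℕ → VarSet) (C : ℕ → CNF) (m : ℕ) →
               (∀ k → k ≤ m → ExistsEquiv (Aux k) (C k) (var (x k) ↔ᶠ G k)) →
               (∀ k → k ≤ m → ¬ OccursF (x k) (G k)) →
               (∀ k l v → k ≤ m → l ≤ m → k ≢ l → Owned (x k) (Aux k) v → ¬ OccursC v (C l)) →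
               (σ : Assignment) →
               Σ Assignment λ ρ →
                 (∀ v → (∀ k → k ≤ m → ¬ Owned (x k) (Aux k) v) → ρ v ≡ σ v) × ρ ⊨ Cs C m
chain-extend x G Aux C zero equiv fresh separated σ
  with define-and-extend (x 0) (G 0) (fresh 0 z≤n) (equiv 0 z≤n) σ
... | ρ , agree , ρ⊨C = ρ , (λ v unowned → agree v (unowned 0 z≤n)) , ρ⊨C
chain-extend x G Aux C (suc m) equiv fresh separated σ
  with chain-extend x G Aux C m (λ k → equiv k ∘ up) (λ k → fresh k ∘ up)
                    (λ k l v k≤m l≤m → separated k l v (up k≤m) (up l≤m)) σ
  where
  up : ∀ {k} → k ≤ m → k ≤ suc m
  up = m≤n⇒m≤1+n
... | ρ , ρ≈σ , ρ⊨Cs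
  with define-and-extend (x (suc m)) (G (suc m)) (fresh (suc m) ≤-refl) (equiv (suc m) ≤-refl) ρ
... | ρ′ , ρ′≈ρ , ρ′⊨C = ρ′ , agree , ++⁺ (⊨-cong (Cs C m) unchanged ρ⊨Cs) ρ′⊨C
  where
  unchanged : ∀ v → OccursC v (Cs C m) → ρ v ≡ ρ′ v
  unchanged v o with Cs-vars C m o
  ... | k , k≤m , o′ = sym (ρ′≈ρ v λ owned →
          separated (suc m) k v ≤-refl (m≤n⇒m≤1+n k≤m) (λ { refl → 1+n≰n k≤m }) owned o′)

  agree : ∀ v → (∀ k → k ≤ suc m → ¬ Owned (x k) (Aux k) v) → ρ′ v ≡ σ v
  agree v unowned = trans (ρ′≈ρ v (unowned (suc m) ≤-refl)) (ρ≈σ v λ k → unowned k ∘ m≤n⇒m≤1+n)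

Contradicting-sym : ∀ {c d} → Contradicting c d → Contradicting d c
Contradicting-sym c∧d=⊥ = c∧d=⊥ ∘ map₂ swap

module TseitinSequence
    (n : ℕ) (X Y T : VarSet) (F : Formula)
    (t : ℕ → Var) (Aux : ℕ → VarSet) (C : ℕ → CNF)
    (I I* : ℕ → Cube)
    (X∩Y=∅ : ∀ v → X v ≡ true → Y v ≡ false)
    (F⊆X∪Y : ∀ v → OccursF v F → (X ∪ Y) v ≡ true)
    (T∩X∪Y=∅ : ∀ v → T v ≡ true → (X ∪ Y) v ≡ false)
    (t∈T : ∀ k → k ≤ suc n → T (t k) ≡ true)
    (t-injective : ∀ k l → k ≤ suc n → l ≤ suc n → t k ≡ t l → k ≡ l)
    (tseitin : ∀ k → k ≤ suc n → IsTseitin (tseitinTarget F X t I* k) (Aux k) (C k))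
    (Aux⊆T : ∀ k v → k ≤ suc n → Aux k v ≡ true → T v ≡ true)
    (Aux-disjoint : ∀ k l v → k ≤ suc n → l ≤ suc n → k ≢ l → Aux k v ≡ true → Aux l v ≡ false)
    (t∉Aux : ∀ k l → k ≤ suc n → l ≤ suc n → Aux k (t l) ≡ false)
    (I-consistent : ∀ i → i ≤ n → Consistent (I (suc i)))
    (I*⊆I : ∀ i → i ≤ n → I* (suc i) ⊆ I (suc i))
    (unsat : ∀ i → i ≤ n → UnsatWith (restrict (X ∪ Y) (I* (suc i))) (Nseq t C i))
  where

  defined : ℕ → Formula
  defined zero = ¬ᶠ F
  defined (suc k) = cubeF (restrict X (I* (suc k)))

  defined-vars : ∀ k {v} → OccursF v (defined k) → (X ∪ Y) v ≡ true
  defined-vars zero (¬-occ o) = F⊆X∪Y _ o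
  defined-vars (suc k) o = ∪-introˡ X Y (cubeF-restrict-vars X (I* (suc k)) o)

  tseitinTarget-vars : ∀ k {v} → OccursF v (tseitinTarget F X t I* k) → v ≡ t k ⊎ (X ∪ Y) v ≡ true
  tseitinTarget-vars zero (↔-l here) = inj₁ refl
  tseitinTarget-vars zero (↔-r o) = inj₂ (defined-vars zero o)
  tseitinTarget-vars (suc k) (↔-l here) = inj₁ refl
  tseitinTarget-vars (suc k) (↔-r o) = inj₂ (defined-vars (suc k) o)

  encoding : ∀ k → k ≤ suc n → ExistsEquiv (Aux k) (C k) (var (t k) ↔ᶠ defined k)
  encoding zero k≤ = IsTseitin.equiv (tseitin zero k≤)
  encoding (suc k) k≤ = IsTseitin.equiv (tseitin (suc k) k≤)

  X∪Y-unowned : ∀ k {v} → k ≤ suc n → (X ∪ Y) v ≡ true → ¬ Owned (t k) (Aux k) v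
  X∪Y-unowned k k≤ X∪Yv (inj₁ refl) = not-¬ X∪Yv (T∩X∪Y=∅ _ (t∈T k k≤))
  X∪Y-unowned k k≤ X∪Yv (inj₂ Auxv) = not-¬ X∪Yv (T∩X∪Y=∅ _ (Aux⊆T k _ k≤ Auxv))

  t-fresh : ∀ k → k ≤ suc n → ¬ OccursF (t k) (defined k)
  t-fresh k k≤ o = X∪Y-unowned k k≤ (defined-vars k o) (inj₁ refl)

  separated : ∀ k l v → k ≤ suc n → l ≤ suc n → k ≢ l → Owned (t k) (Aux k) v → ¬ OccursC v (C l)
  separated k l v k≤ l≤ k≢l owned o with IsTseitin.vars (tseitin l l≤) v o | owned
  ... | inj₂ Auxₗv | inj₁ refl = not-¬ Auxₗv (t∉Aux l k l≤ k≤)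
  ... | inj₂ Auxₗv | inj₂ Auxₖv = not-¬ Auxₗv (Aux-disjoint k l v k≤ l≤ k≢l Auxₖv)
  ... | inj₁ o′ | _ with tseitinTarget-vars l o′
  ...   | inj₂ X∪Yv = X∪Y-unowned k k≤ X∪Yv owned
  ...   | inj₁ refl with owned
  ...     | inj₁ tₗ≡tₖ = k≢l (t-injective k l k≤ l≤ (sym tₗ≡tₖ))
  ...     | inj₂ Auxₖtₗ = not-¬ Auxₖtₗ (t∉Aux k l k≤ l≤)

  below : ∀ {k m} → m ≤ n → k ≤ m → k ≤ suc n
  below m≤n k≤m = ≤-trans k≤m (≤-trans m≤n (n≤1+n n))

  extension : ∀ m → m ≤ n → (σ : Assignment) →
              Σ Assignment λ ρ → (∀ v → (X ∪ Y) v ≡ true → ρ v ≡ σ v) × ρ ⊨ Cs C m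
  extension m m≤n σ
    with chain-extend t defined Aux C m (λ k → encoding k ∘ below m≤n) (λ k → t-fresh k ∘ below m≤n)
                      (λ k l v k≤m l≤m → separated k l v (below m≤n k≤m) (below m≤n l≤m)) σ
  ... | ρ , ρ≈σ , ρ⊨Cs = ρ , (λ v X∪Yv → ρ≈σ v λ k k≤m → X∪Y-unowned k (below m≤n k≤m) X∪Yv) , ρ⊨Cs

  earlier-cube-excluded : ∀ {i m} → i < m → m ≤ n →
                          Contradicting (restrict X (I* (suc i))) (restrict X (I* (suc m)))
  earlier-cube-excluded {i} {m} i<m m≤n (σ , σ⊨cubeᵢ , σ⊨cubeₘ)
    with extension m m≤n (override Y (restrict (X ∪ Y) (I* (suc m))) σ)
  ... | ρ , ρ≈σY , ρ⊨Cs = unsat m m≤n (ρ , ρ⊨cube , lose (tClause-∋ t m i<m) ρ⊨tᵢ ∷ ρ⊨Cs)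
    where
    cube : Cube
    cube = restrict (X ∪ Y) (I* (suc m))

    ρ≈σ : ∀ v → X v ≡ true → ρ v ≡ σ v
    ρ≈σ v Xv = trans (ρ≈σY v (∪-introˡ X Y Xv)) (override-off Y cube σ (X∩Y=∅ v Xv))

    σ-fits-cube : ∀ {l} → l ∈ cube → Y (litVar l) ≡ false → σ ⊨ˡ l
    σ-fits-cube l∈cube Yl with ∈-restrict⁻ (X ∪ Y) (I* (suc m)) l∈cube
    ... | l∈I* , X∪Yl = lookup σ⊨cubeₘ (∈-restrict⁺ X (I* (suc m)) l∈I* (∪-elimˡ X Y X∪Yl Yl))

    ρ⊨cube : ρ ⊨ᶜᵘ cube
    ρ⊨cube = ⊨ᶜᵘ-cong cube (λ l∈ → sym (ρ≈σY _ (proj₂ (∈-restrict⁻ (X ∪ Y) (I* (suc m)) l∈))))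
               (override-⊨ᶜᵘ Y cube σ cube-consistent σ-fits-cube)
      where
      cube-consistent : Consistent cube
      cube-consistent = consistent-⊆ (I*⊆I m m≤n ∘ restrict-⊆ (X ∪ Y) (I* (suc m))) (I-consistent m m≤n)

    ρ⊨tᵢ : ρ ⊨ˡ pos (t (suc i))
    ρ⊨tᵢ = xnor-true ρ-defines-tᵢ (⟦cubeF⟧-true cubeᵢ ρ⊨cubeᵢ)
      where
      cubeᵢ : Cube
      cubeᵢ = restrict X (I* (suc i))

      ρ-defines-tᵢ : ⟦ var (t (suc i)) ↔ᶠ defined (suc i) ⟧ ρ ≡ true
      ρ-defines-tᵢ = ExistsEquiv-sound (var (t (suc i)) ↔ᶠ defined (suc i))
                       (encoding (suc i) (below m≤n i<m)) (Cs-⊨⁻ C m ρ⊨Cs i<m)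

      ρ⊨cubeᵢ : ρ ⊨ᶜᵘ cubeᵢ
      ρ⊨cubeᵢ = ⊨ᶜᵘ-cong cubeᵢ (λ l∈ → sym (ρ≈σ _ (proj₂ (∈-restrict⁻ X (I* (suc i)) l∈)))) σ⊨cubeᵢ

  pairwise-contradicting : ∀ i j → 1 ≤ i → i ≤ suc n → 1 ≤ j → j ≤ suc n → i ≢ j →
                           Contradicting (restrict X (I* i)) (restrict X (I* j))
  pairwise-contradicting (suc i) (suc j) _ i≤ _ j≤ i≢j with <-cmp i j
  ... | tri< i<j _ _ = earlier-cube-excluded i<j (≤-pred j≤)
  ... | tri≈ _ refl _ = contradiction refl i≢j
  ... | tri> _ _ j<i = Contradicting-sym (earlier-cube-excluded j<i (≤-pred i≤))

proposition1 :
    (n : ℕ) (X Y S T : VarSet) (F : Formula) (P₀ : CNF)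
    (t : ℕ → Var) (Aux : ℕ → VarSet) (C : ℕ → CNF)
    (I I* : ℕ → Cube) →
    -- X, Y disjoint; F is a formula over X ∪ Y
    (∀ v → X v ≡ true → Y v ≡ false) →
    (∀ v → OccursF v F → (X ∪ Y) v ≡ true) →
    -- S, T are sets of auxiliary variables: disjoint from X ∪ Y and from each other
    (∀ v → S v ≡ true → (X ∪ Y) v ≡ false) →
    (∀ v → T v ≡ true → (X ∪ Y) v ≡ false) →
    (∀ v → S v ≡ true → T v ≡ false) →
    -- P₀ : CNF over X ∪ Y ∪ S with ∃S [P₀] ≡ F
    (∀ v → OccursC v P₀ → ((X ∪ Y) ∪ S) v ≡ true) →
    ExistsEquiv S P₀ F →
    -- t₀, t₁, … are distinct variables of T
    (∀ k → k ≤ suc n → T (t k) ≡ true) →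
    (∀ k l → k ≤ suc n → l ≤ suc n → t k ≡ t l → k ≡ l) →
    -- C k = Tseitin(t₀ ↔ ¬F) (k = 0), Tseitin(t_k ↔ I*_k|_X) (k ≥ 1),
    -- with auxiliary variables Aux k ⊆ T, fresh w.r.t. each other and the t's
    (∀ k → k ≤ suc n → IsTseitin (tseitinTarget F X t I* k) (Aux k) (C k)) →
    (∀ k v → k ≤ suc n → Aux k v ≡ true → T v ≡ true) →
    (∀ k l v → k ≤ suc n → l ≤ suc n → k ≢ l → Aux k v ≡ true → Aux l v ≡ false) →
    (∀ k l → k ≤ suc n → l ≤ suc n → Aux k (t l) ≡ false) →
    -- N₀ = t₀ ∧ Tseitin(t₀ ↔ ¬F) satisfies ∃T [N₀] ≡ ¬F
    ExistsEquiv T (Nseq t C zero) (¬ᶠ F) →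
    -- for i = 0..n: I_{i+1} ⊢ P_i, I*_{i+1} ⊆ I_{i+1}, I*_{i+1}|_{X∪Y} ∧ N_i unsat
    (∀ i → i ≤ n → Consistent (I (suc i))) →
    (∀ i → i ≤ n → I (suc i) ⊢ Pseq P₀ X I* i) →
    (∀ i → i ≤ n → I* (suc i) ⊆ I (suc i)) →
    (∀ i → i ≤ n → UnsatWith (restrict (X ∪ Y) (I* (suc i))) (Nseq t C i)) →
    -- conclusion
    ∀ i j → 1 ≤ i → i ≤ suc n → 1 ≤ j → j ≤ suc n → i ≢ j →
    Contradicting (restrict X (I* i)) (restrict X (I* j))
proposition1 n X Y S T F P₀ t Aux C I I* X∩Y=∅ F⊆X∪Y _ T∩X∪Y=∅ _ _ _ t∈T t-injective
             tseitin Aux⊆T Aux-disjoint t∉Aux _ I-consistent _ I*⊆I unsat =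
  TseitinSequence.pairwise-contradicting n X Y T F t Aux C I I* X∩Y=∅ F⊆X∪Y T∩X∪Y=∅ t∈T
    t-injective tseitin Aux⊆T Aux-disjoint t∉Aux I-consistent I*⊆I unsat
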